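{- Let $\Psi$ be a weighted directed graph with finite vertex set ${\tt N}$, let $\aleph$ be a partition of ${\tt N}$, and let $F$ be a spanning entering forest of $\Psi$ with exactly $k$ trees which is tree-divisible by $\aleph$. Then the splitting $F^\aleph=F|\aleph$ of $F$ by $\aleph$ is an entering forest consisting of $k$ trees and has exactly $|\aleph|-k$ arcs.
   Context: An entering forest is a directed graph in which at most one arc leaves each vertex and there are no directed cycles; its components are entering trees, whose root is the unique vertex with no outgoing arc. $G|_{\tt D}$ is the subgraph of $G$ induced by ${\tt D}$. For a directed graph $G$ with vertex set ${\tt N}$ and ${\tt D}\subseteq{\tt N}$: ${\cal T}^\bullet_{\tt D}(G)$ is the set of entering trees that are subgraphs of $G$ with vertex set ${\tt D}$; ${\cal T}^\circ_{\tt D}(G)$ is the set of entering trees $T$ that are subgraphs of $G$ with ${\tt D}\subset{\tt V}T$, $|{\tt V}T|=|{\tt D}|+1$ and $T|_{\tt D}\in{\cal T}^\bullet_{\tt D}(G)$ (so the root of $T$ lies outside ${\tt D}$). For distinct ${\tt X},{\tt Y}\in\aleph$, ${\cal T}_{\tt XY}(G)$ is the set of $T\in{\cal T}^\circ_{\tt X}(G)$ whose root lies in ${\tt Y}$. $G$ is tree-divisible by the partition $\aleph$ if ${\cal T}^\bullet_{\tt X}(G)\neq\emptyset$ for every ${\tt X}\in\aleph$ (for a spanning forest $F$ this means $F|_{\tt X}$ is a tree for each ${\tt X}\in\aleph$). The splitting $G|\aleph=G^\aleph$ of a tree-divisible $G$ is the directed graph with vertex set $\aleph$ having an arc $({\tt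 X},{\tt Y})$ (${\tt X}\ne{\tt Y}$) if and only if ${\cal T}_{\tt XY}(G)\neq\emptyset$. -}

module Defs where

open import Data.Nat using (ℕ)
open import Data.Fin using (Fin; _≟_)
open import Data.Bool using (Bool; true; false; _∨_)
open import Data.Product using (Σ; ∃; ∃-syntax; _×_; _,_)
open import Relation.Nullary using (¬_)
open import Relation.Nullary.Decidable using (⌊_⌋)
open import Relation.Binary.PropositionalEquality using (_≡_; _≢_)
open import Function.Bundles using (_⇔_)
open import Function.Definitions using (Injective)

BGraph : ℕ → Set
BGraph n = Fin n → Fin n → Bool

VSet : ℕ → Set
VSet n = Fin n → Bool

⟦_⟧ : ∀ {n} → BGraph n → Fin n → Fin n → Set
⟦ G ⟧ u v = G u v ≡ true

module _ {n : ℕ} where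

  _⊆G_ : BGraph n → BGraph n → Set
  H ⊆G G = ∀ u v → ⟦ H ⟧ u v → ⟦ G ⟧ u v

  ArcsIn : VSet n → (Fin n → Fin n → Set) → Set
  ArcsIn S A = ∀ u v → A u v → S u ≡ true × S v ≡ true

  OutAtMostOne : (Fin n → Fin n → Set) → Set
  OutAtMostOne A = ∀ u v w → A u v → A u w → v ≡ w

  data Path (A : Fin n → Fin n → Set) : Fin n → Fin n → Set where
    one : ∀ {u v} → A u v → Path A u v
    _∷_ : ∀ {u v w} → A u v → Path A v w → Path A u w

  NoDirectedCycle : (Fin n → Fin n → Set) → Set
  NoDirectedCycle A = ∀ u → ¬ Path A u u

  EnteringForest : (Fin n → Fin n → Set) → Set
  EnteringForest A = OutAtMostOne A × NoDirectedCycle A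

  data Conn (A : Fin n → Fin n → Set) : Fin n → Fin n → Set where
    here : ∀ {u} → Conn A u u
    fwd  : ∀ {u v w} → A u v → Conn A v w → Conn A u w
    bwd  : ∀ {u v w} → A v u → Conn A v w → Conn A u w

  EnteringTreeOn : VSet n → (Fin n → Fin n → Set) → Set
  EnteringTreeOn S A =
    ArcsIn S A × EnteringForest A × (∃[ u ] S u ≡ true) ×
    (∀ u v → S u ≡ true → S v ≡ true → Conn A u v)

  IsRoot : VSet n → (Fin n → Fin n → Set) → Fin n → Set
  IsRoot S A r = S r ≡ true × (∀ v → ¬ A r v)

  restrict : BGraph n → VSet n → Fin n → Fin n → Set
  restrict H D u v = ⟦ H ⟧ u v × D u ≡ true × D v ≡ true

  TreeBullet : BGraph n → VSet n → BGraph n → Set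
  TreeBullet G D T = T ⊆G G × EnteringTreeOn D ⟦ T ⟧

  insertV : VSet n → Fin n → VSet n
  insertV D y v = D v ∨ ⌊ v ≟ y ⌋

  TreeCirc : BGraph n → VSet n → Fin n → BGraph n → Set
  TreeCirc G D y T =
    D y ≡ false × T ⊆G G × EnteringTreeOn (insertV D y) ⟦ T ⟧ ×
    EnteringTreeOn D (restrict T D)

module _ {n m : ℕ} where

  -- a partition ℵ of Fin n into m (nonempty) blocks, encoded by the
  -- surjective block-assignment p; block X is { v | p v ≡ X }
  IsPartition : (Fin n → Fin m) → Set
  IsPartition p = ∀ X → ∃[ v ] p v ≡ X

  block : (Fin n → Fin m) → Fin m → VSet n
  block p X v = ⌊ p v ≟ X ⌋

  TreeDivisible : BGraph n → (Fin n → Fin m) → Set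
  TreeDivisible G p = ∀ X → ∃[ T ] TreeBullet G (block p X) T

  TXYNonempty : BGraph n → (Fin n → Fin m) → Fin m → Fin m → Set
  TXYNonempty G p X Y =
    ∃[ y ] ∃[ T ] (TreeCirc G (block p X) y T ×
      ∃[ r ] (IsRoot (insertV (block p X) y) ⟦ T ⟧ r × p r ≡ Y))

  Splitting : BGraph n → (Fin n → Fin m) → Fin m → Fin m → Set
  Splitting G p X Y = X ≢ Y × TXYNonempty G p X Y

module _ {n : ℕ} where

  HasComponents : (Fin n → Fin n → Set) → ℕ → Set
  HasComponents A k =
    Σ (Fin n → Fin k) λ c →
      (∀ i → ∃[ u ] c u ≡ i) × (∀ u v → (c u ≡ c v) ⇔ Conn A u v)

  HasArcCount : (Fin n → Fin n → Set) → ℕ → Set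
  HasArcCount A c =
    Σ (Fin c → Fin n × Fin n) λ e →
      Injective _≡_ _≡_ e × (∀ u v → A u v ⇔ (∃[ i ] e i ≡ (u , v)))

{-# OPTIONS --safe #-}
-- Write X → Y for the contraction of F by ℵ: X ≠ Y and some arc of F goes from block X to block Y.
-- It coincides with the splitting: the tree of block X plus such an arc lies in 𝒯_XY, and conversely
-- the root of a tree in 𝒯_XY is entered from X. Since F has out-degree at most one, a vertex with an
-- arc leaving its block is the root of the block's tree, hence unique in its block; so the contraction
-- has out-degree at most one, its cycles lift to cycles of F, and (blocks being connected) its weak
-- components are those of F. Finally an entering forest on m vertices with k components has m − k arcs:
-- arcs correspond to their sources, the non-roots, and each component contains exactly one root,
-- reached from any of its vertices by following arcs since the graph is finite and acyclic.
module Submission where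

open import Defs
open import Data.Nat using (ℕ; zero; suc; _+_; _∸_)
open import Data.Nat.Properties using (+-suc; n<1+n; m≤n⇒∃[o]m+o≡n; m+n∸n≡m; ≤-antisym)
open import Data.Fin using (Fin; zero; suc; toℕ; _≟_)
open import Data.Fin.Properties using (any?; pigeonhole; injective⇒≤; suc-injective)
open import Data.Product using (Σ; ∃; ∃₂; ∃-syntax; _×_; _,_; proj₁; proj₂; curry; uncurry)
open import Data.Empty using (⊥-elim)
open import Data.Bool using (true; false; _∨_)
import Data.Bool as Bool
open import Data.Bool.Properties using (∨-zeroʳ; T-≡; T-not-≡)
open import Data.Sum using (_⊎_; inj₁; inj₂)
open import Function using (_∘_)
open import Function.Bundles using (_⇔_; mk⇔; Equivalence)
open import Function.Definitions using (Injective)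
open import Relation.Binary.Core using (Rel; _⇒_)
open import Relation.Binary.Definitions using (Decidable)
open import Relation.Binary.Construct.Closure.ReflexiveTransitive using (Star; ε; _◅_)
import Relation.Binary.Construct.Closure.ReflexiveTransitive as Star
open import Relation.Nullary using (¬_; Dec; yes; no; ¬?)
open import Relation.Nullary.Decidable using (_×-dec_; ⌊_⌋; toWitness; fromWitness; fromWitnessFalse)
open import Relation.Unary as U using (Pred; ∁)
open import Relation.Binary.PropositionalEquality
  using (_≡_; _≢_; refl; sym; trans; cong; cong₂; subst; subst₂; module ≡-Reasoning)
open import Level using (0ℓ)

Graph : ℕ → Set₁
Graph n = Rel (Fin n) 0ℓ

Root : ∀ {n} → Graph n → Fin n → Set
Root R r = ¬ ∃ (R r)

module _ {n : ℕ} {R S : Graph n} where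

  Path-map : R ⇒ S → ∀ {u v} → Path R u v → Path S u v
  Path-map f (one a) = one (f a)
  Path-map f (a ∷ π) = f a ∷ Path-map f π

  Conn-map : R ⇒ S → ∀ {u v} → Conn R u v → Conn S u v
  Conn-map f here = here
  Conn-map f (fwd a γ) = fwd (f a) (Conn-map f γ)
  Conn-map f (bwd a γ) = bwd (f a) (Conn-map f γ)

  EnteringForest-sub : R ⇒ S → EnteringForest S → EnteringForest R
  EnteringForest-sub f (out , acyclic) =
    (λ u v w a b → out u v w (f a) (f b)) , (λ u → acyclic u ∘ Path-map f)

module _ {n : ℕ} {R S : Graph n} (R⇒S : R ⇒ S) (S⇒R : S ⇒ R) where

  HasComponents-resp : ∀ {k} → HasComponents R k → HasComponents S k
  HasComponents-resp (c , surjective , spec) = c , surjective , λ u v →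
    mk⇔ (Conn-map R⇒S ∘ Equivalence.to (spec u v)) (Equivalence.from (spec u v) ∘ Conn-map S⇒R)

  HasArcCount-resp : ∀ {c} → HasArcCount R c → HasArcCount S c
  HasArcCount-resp (e , injective , spec) = e , injective , λ u v →
    mk⇔ (Equivalence.to (spec u v) ∘ S⇒R) (R⇒S ∘ Equivalence.from (spec u v))

module _ {n : ℕ} {R : Graph n} where

  infixr 5 _◅ₚ_ _◅◅ₚ_ _++ᶜ_

  _◅ₚ_ : ∀ {u v w} → R u v → Star R v w → Path R u w
  a ◅ₚ ε = one a
  a ◅ₚ (b ◅ σ) = a ∷ (b ◅ₚ σ)

  _◅◅ₚ_ : ∀ {u v w} → Star R u v → Path R v w → Path R u w
  ε ◅◅ₚ π = π
  (a ◅ σ) ◅◅ₚ π = a ∷ (σ ◅◅ₚ π)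

  _++ᶜ_ : ∀ {u v w} → Conn R u v → Conn R v w → Conn R u w
  here ++ᶜ δ = δ
  fwd a γ ++ᶜ δ = fwd a (γ ++ᶜ δ)
  bwd a γ ++ᶜ δ = bwd a (γ ++ᶜ δ)

  first-arc : ∀ {u v} → Path R u v → ∃ (R u)
  first-arc (one a) = _ , a
  first-arc (a ∷ _) = _ , a

  Conn-sym : ∀ {u v} → Conn R u v → Conn R v u
  Conn-sym here = here
  Conn-sym (fwd a γ) = Conn-sym γ ++ᶜ bwd a here
  Conn-sym (bwd a γ) = Conn-sym γ ++ᶜ fwd a here

  Star⇒Conn : ∀ {u v} → Star R u v → Conn R u v
  Star⇒Conn ε = here
  Star⇒Conn (a ◅ σ) = fwd a (Star⇒Conn σ)

  module _ (out : OutAtMostOne R) where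

    arc-reaches-root : ∀ {u v r} → R u v → Star R u r → Root R r → Star R v r
    arc-reaches-root a ε root = ⊥-elim (root (_ , a))
    arc-reaches-root a (b ◅ σ) root with out _ _ _ a b
    ... | refl = σ

    conn-reaches-root : ∀ {u v r} → Conn R u v → Star R u r → Root R r → Star R v r
    conn-reaches-root here σ root = σ
    conn-reaches-root (fwd a γ) σ root = conn-reaches-root γ (arc-reaches-root a σ root) root
    conn-reaches-root (bwd a γ) σ root = conn-reaches-root γ (a ◅ σ) root

    roots-unique : ∀ {u v} → Conn R u v → Root R u → Root R v → u ≡ v
    roots-unique γ root-u root-v with conn-reaches-root γ ε root-u
    ... | ε = refl
    ... | a ◅ _ = ⊥-elim (root-v (_ , a))

module _ {m : ℕ} {R : Graph m} (R? : Decidable R) where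

  successor : Fin m → Fin m
  successor u with any? (R? u)
  ... | yes (v , _) = v
  ... | no _ = u

  walk : ℕ → Fin m → Fin m
  walk zero u = u
  walk (suc i) u = walk i (successor u)

  walk-+ : ∀ i j u → walk (i + j) u ≡ walk j (walk i u)
  walk-+ zero j u = refl
  walk-+ (suc i) j u = walk-+ i j (successor u)

  walk-star : ∀ i u → Star R u (walk i u)
  walk-star zero u = ε
  walk-star (suc i) u with any? (R? u)
  ... | yes (v , a) = a ◅ walk-star i v
  ... | no _ = walk-star i u

  returning-walk-root : NoDirectedCycle R → ∀ i u → walk (suc i) u ≡ u → Root R u
  returning-walk-root acyclic i u returns with any? (R? u)
  ... | yes (v , a) = λ _ → acyclic u (a ◅ₚ subst (Star R v) returns (walk-star i v))
  ... | no no-arc = no-arc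

  -- Pigeonhole: among the first m + 1 vertices of the walk one repeats, and a walk only returns to a root.
  root-reachable : NoDirectedCycle R → ∀ u → ∃[ r ] (Star R u r × Root R r)
  root-reachable acyclic u with pigeonhole (n<1+n m) (λ i → walk (toℕ i) u)
  ... | i , j , i<j , same with m≤n⇒∃[o]m+o≡n i<j
  ... | d , i+1+d≡j = walk (toℕ i) u , walk-star (toℕ i) u ,
      returning-walk-root acyclic d (walk (toℕ i) u) (begin
        walk (suc d) (walk (toℕ i) u)   ≡⟨ walk-+ (toℕ i) (suc d) u ⟨
        walk (toℕ i + suc d) u          ≡⟨ cong (λ t → walk t u) (trans (+-suc (toℕ i) d) i+1+d≡j) ⟩
        walk (toℕ j) u                  ≡⟨ same ⟨
        walk (toℕ i) u                  ∎)
    where open ≡-Reasoning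

Enumerates : {A : Set} → Pred A 0ℓ → ℕ → Set
Enumerates {A} P c = Σ (Fin c → A) λ e → Injective _≡_ _≡_ e × (∀ a → P a ⇔ (∃[ i ] e i ≡ a))

module _ {m : ℕ} {P : Pred (Fin (suc m)) 0ℓ} where

  Enumerates-cons : ∀ {c} → P zero → Enumerates (P ∘ suc) c → Enumerates P (suc c)
  Enumerates-cons P0 (e , injective , spec) = e′ , injective′ , spec′
    where
    e′ : Fin (suc _) → Fin (suc m)
    e′ zero = zero
    e′ (suc i) = suc (e i)

    injective′ : Injective _≡_ _≡_ e′
    injective′ {zero} {zero} _ = refl
    injective′ {suc i} {suc j} eq = cong suc (injective (suc-injective eq))
    injective′ {zero} {suc _} ()
    injective′ {suc _} {zero} ()

    spec′ : ∀ a → P a ⇔ (∃[ i ] e′ i ≡ a)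
    spec′ zero = mk⇔ (λ _ → zero , refl) (λ _ → P0)
    spec′ (suc a) = mk⇔
      (λ Pa → let i , ei≡a = Equivalence.to (spec a) Pa in suc i , cong suc ei≡a)
      (λ { (zero , ()) ; (suc i , ei≡a) → Equivalence.from (spec a) (i , suc-injective ei≡a) })

  Enumerates-skip : ∀ {c} → ¬ P zero → Enumerates (P ∘ suc) c → Enumerates P c
  Enumerates-skip ¬P0 (e , injective , spec) = suc ∘ e , injective ∘ suc-injective , spec′
    where
    spec′ : ∀ a → P a ⇔ (∃[ i ] suc (e i) ≡ a)
    spec′ zero = mk⇔ (⊥-elim ∘ ¬P0) λ ()
    spec′ (suc a) = mk⇔
      (λ Pa → let i , ei≡a = Equivalence.to (spec a) Pa in i , cong suc ei≡a)
      (λ (i , ei≡a) → Equivalence.from (spec a) (i , suc-injective ei≡a))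

enumerate-split : ∀ {m} {P : Pred (Fin m) 0ℓ} → U.Decidable P →
              ∃₂ λ a b → a + b ≡ m × Enumerates P a × Enumerates (∁ P) b
enumerate-split {zero} P? = 0 , 0 , refl , empty , empty
  where
  empty : ∀ {Q} → Enumerates Q 0
  empty = (λ ()) , (λ { {()} }) , (λ ())
enumerate-split {suc m} P? with enumerate-split (P? ∘ suc) | P? zero
... | a , b , a+b≡m , yes-P , no-P | yes P0 =
  suc a , b , cong suc a+b≡m , Enumerates-cons P0 yes-P , Enumerates-skip (λ ¬P0 → ¬P0 P0) no-P
... | a , b , a+b≡m , yes-P , no-P | no ¬P0 =
  a , suc b , trans (+-suc a b) (cong suc a+b≡m) , Enumerates-skip ¬P0 yes-P , Enumerates-cons ¬P0 no-P

module _ {m : ℕ} {R : Graph m} (out : OutAtMostOne R) where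

  sources⇒arcCount : ∀ {c} → Enumerates (∃ ∘ R) c → HasArcCount R c
  sources⇒arcCount (e , injective , spec) =
    arc , injective ∘ cong proj₁ , λ u v → mk⇔ (to u v) (from u v)
    where
    arc : Fin _ → Fin m × Fin m
    arc i = e i , proj₁ (Equivalence.from (spec (e i)) (i , refl))

    to : ∀ u v → R u v → ∃[ i ] arc i ≡ (u , v)
    to u v a with Equivalence.to (spec u) (v , a)
    ... | i , refl = i , cong (e i ,_) (out _ _ _ (proj₂ (Equivalence.from (spec (e i)) (i , refl))) a)

    from : ∀ u v → ∃[ i ] arc i ≡ (u , v) → R u v
    from _ _ (i , refl) = proj₂ (Equivalence.from (spec (e i)) (i , refl))

  roots≡components : ∀ {b k} → (∀ u → ∃[ r ] (Star R u r × Root R r)) →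
                     HasComponents R k → Enumerates (Root R) b → b ≡ k
  roots≡components reach (c , surjective , c-spec) (e , e-injective , spec) =
    ≤-antisym (injective⇒≤ component-injective) (injective⇒≤ root-injective)
    where
    root-e : ∀ i → Root R (e i)
    root-e i = Equivalence.from (spec (e i)) (i , refl)

    component-injective : Injective _≡_ _≡_ (c ∘ e)
    component-injective {i} {j} same =
      e-injective (roots-unique out (Equivalence.to (c-spec (e i) (e j)) same) (root-e i) (root-e j))

    root-in : ∀ κ → ∃[ i ] c (e i) ≡ κ
    root-in κ with surjective κ
    ... | u , refl with reach u
    ... | r , σ , root with Equivalence.to (spec r) root
    ... | i , refl = i , Equivalence.from (c-spec r u) (Conn-sym (Star⇒Conn σ))

    root-injective : Injective _≡_ _≡_ (proj₁ ∘ root-in)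
    root-injective {κ} {λ′} eq =
      trans (sym (proj₂ (root-in κ))) (trans (cong (c ∘ e) eq) (proj₂ (root-in λ′)))

forest-arcCount : ∀ {m k} {R : Graph m} → Decidable R → EnteringForest R → HasComponents R k →
                  HasArcCount R (m ∸ k)
forest-arcCount {m} {k} {R} R? (out , acyclic) components with enumerate-split (λ u → any? (R? u))
... | a , b , a+b≡m , sources , roots = subst (HasArcCount R) a≡m∸k (sources⇒arcCount out sources)
  where
  a≡m∸k : a ≡ m ∸ k
  a≡m∸k = trans (sym (m+n∸n≡m a b))
            (cong₂ _∸_ a+b≡m (roots≡components out (root-reachable R? acyclic) components roots))

module _ {n m : ℕ} (p : Fin n → Fin m) where

  Contraction : Graph n → Graph m
  Contraction R X Y = X ≢ Y × ∃[ x ] ∃[ y ] (R x y × p x ≡ X × p y ≡ Y)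

  IntraBlock : Graph n → Graph n
  IntraBlock R u v = R u v × p u ≡ p v

  BlocksConnected : Graph n → Set
  BlocksConnected R = ∀ u v → p u ≡ p v → Conn (IntraBlock R) u v

  Leaves : Graph n → Fin n → Set
  Leaves R a = ∃[ b ] (R a b × p b ≢ p a)

  contraction? : ∀ {R} → Decidable R → Decidable (Contraction R)
  contraction? R? X Y = ¬? (X ≟ Y) ×-dec any? λ x → any? λ y → R? x y ×-dec p x ≟ X ×-dec p y ≟ Y

  project-conn : ∀ {R u v} → Conn R u v → Conn (Contraction R) (p u) (p v)
  project-conn here = here
  project-conn (fwd {u} {w} a γ) with p u ≟ p w
  ... | yes same rewrite same = project-conn γ
  ... | no differ = fwd (differ , u , w , a , refl , refl) (project-conn γ)
  project-conn (bwd {u} {w} a γ) with p u ≟ p w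
  ... | yes same rewrite same = project-conn γ
  ... | no differ = bwd (differ ∘ sym , w , u , a , refl , refl) (project-conn γ)

  module _ {R : Graph n} (connected : BlocksConnected R) where

    block-conn : ∀ {u v} → p u ≡ p v → Conn R u v
    block-conn {u} {v} same = Conn-map proj₁ (connected u v same)

    lift-conn : ∀ {X Y u v} → Conn (Contraction R) X Y → p u ≡ X → p v ≡ Y → Conn R u v
    lift-conn here u∈X v∈X = block-conn (trans u∈X (sym v∈X))
    lift-conn (fwd (_ , x , y , xy , refl , refl) γ) u∈X v∈Z =
      block-conn u∈X ++ᶜ fwd xy (lift-conn γ refl v∈Z)
    lift-conn (bwd (_ , y , x , yx , refl , refl) γ) u∈X v∈Z =
      block-conn u∈X ++ᶜ bwd yx (lift-conn γ refl v∈Z)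

    contraction-components : ∀ {k} → IsPartition p → HasComponents R k → HasComponents (Contraction R) k
    contraction-components partition (c , surjective , c-spec) = c ∘ rep , surjective′ , c-spec′
      where
      rep : Fin m → Fin n
      rep X = proj₁ (partition X)

      rep∈ : ∀ X → p (rep X) ≡ X
      rep∈ X = proj₂ (partition X)

      surjective′ : ∀ κ → ∃[ X ] c (rep X) ≡ κ
      surjective′ κ with surjective κ
      ... | u , refl = p u , Equivalence.from (c-spec (rep (p u)) u) (block-conn (rep∈ (p u)))

      c-spec′ : ∀ X Y → (c (rep X) ≡ c (rep Y)) ⇔ Conn (Contraction R) X Y
      c-spec′ X Y = mk⇔
        (λ same → subst₂ (Conn (Contraction R)) (rep∈ X) (rep∈ Y)
                    (project-conn (Equivalence.to (c-spec (rep X) (rep Y)) same)))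
        (λ γ → Equivalence.from (c-spec (rep X) (rep Y)) (lift-conn γ (rep∈ X) (rep∈ Y)))

    module _ (out : OutAtMostOne R) where

      leaving-root : ∀ {a} → Leaves R a → Root (IntraBlock R) a
      leaving-root (b , ab , b∉block) (v , av , same) with out _ _ _ ab av
      ... | refl = b∉block (sym same)

      out-intra : OutAtMostOne (IntraBlock R)
      out-intra u v w a b = out u v w (proj₁ a) (proj₁ b)

      star-to-leaving : ∀ {u a} → p u ≡ p a → Leaves R a → Star R u a
      star-to-leaving {u} {a} same leaves =
        Star.map proj₁ (conn-reaches-root out-intra (connected a u (sym same)) ε (leaving-root leaves))

      leaving-unique : ∀ {a a′} → p a ≡ p a′ → Leaves R a → Leaves R a′ → a ≡ a′
      leaving-unique {a} {a′} same leaves leaves′ =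
        roots-unique out-intra (connected a a′ same) (leaving-root leaves) (leaving-root leaves′)

      contraction-out : OutAtMostOne (Contraction R)
      contraction-out _ _ _ (X≢Y , x , y , xy , refl , refl) (X≢Y′ , x′ , y′ , x′y′ , x′∈X , refl)
        with leaving-unique (sym x′∈X) (y , xy , X≢Y ∘ sym)
                            (y′ , x′y′ , λ e → X≢Y′ (sym (trans e x′∈X)))
      ... | refl = cong p (out _ _ _ xy x′y′)

      lift-path : ∀ {X Z u z} → Path (Contraction R) X Z → p u ≡ X → p z ≡ Z → Leaves R z →
                  Path R u z
      lift-path (one (X≢Y , x , y , xy , refl , refl)) u∈X z∈Y z-leaves =
        star-to-leaving u∈X (y , xy , X≢Y ∘ sym) ◅◅ₚ xy ◅ₚ star-to-leaving (sym z∈Y) z-leaves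
      lift-path ((X≢Y , x , y , xy , refl , refl) ∷ π) u∈X z∈Z z-leaves =
        star-to-leaving u∈X (y , xy , X≢Y ∘ sym) ◅◅ₚ xy ∷ lift-path π refl z∈Z z-leaves

      contraction-acyclic : NoDirectedCycle R → NoDirectedCycle (Contraction R)
      contraction-acyclic acyclic X π with first-arc π
      ... | _ , (X≢Y , x , y , xy , refl , refl) = acyclic x (lift-path π refl refl (y , xy , X≢Y ∘ sym))

    contraction-forest : EnteringForest R → EnteringForest (Contraction R)
    contraction-forest (out , acyclic) = contraction-out out , contraction-acyclic out acyclic

∨⁺ˡ : ∀ {b} c → b ≡ true → b ∨ c ≡ true
∨⁺ˡ c refl = refl

module _ {A : Set} where

  ⌊⌋⁺ : (a? : Dec A) → A → ⌊ a? ⌋ ≡ true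
  ⌊⌋⁺ a? = Equivalence.to T-≡ ∘ fromWitness

  ⌊⌋⁻ : (a? : Dec A) → ⌊ a? ⌋ ≡ true → A
  ⌊⌋⁻ a? = toWitness ∘ Equivalence.from T-≡

  ⌊⌋-false : (a? : Dec A) → ¬ A → ⌊ a? ⌋ ≡ false
  ⌊⌋-false a? = Equivalence.to T-not-≡ ∘ fromWitnessFalse

  ∨-⌊⌋⁺ʳ : ∀ b (a? : Dec A) → A → b ∨ ⌊ a? ⌋ ≡ true
  ∨-⌊⌋⁺ʳ b a? a = trans (cong (b ∨_) (⌊⌋⁺ a? a)) (∨-zeroʳ b)

  ∨-⌊⌋⁻ : ∀ b (a? : Dec A) → b ∨ ⌊ a? ⌋ ≡ true → b ≡ true ⊎ A
  ∨-⌊⌋⁻ true a? _ = inj₁ refl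
  ∨-⌊⌋⁻ false a? = inj₂ ∘ ⌊⌋⁻ a?

module _ {n : ℕ} where

  addArc : BGraph n → Fin n → Fin n → BGraph n
  addArc T x y u v = T u v ∨ ⌊ u ≟ x ×-dec v ≟ y ⌋

  module _ (D : VSet n) (y : Fin n) where

    insertV⁺ˡ : ∀ {v} → D v ≡ true → insertV D y v ≡ true
    insertV⁺ˡ = ∨⁺ˡ _

    insertV⁺ʳ : insertV D y y ≡ true
    insertV⁺ʳ = ∨-⌊⌋⁺ʳ (D y) (y ≟ y) refl

    insertV⁻ : ∀ {v} → insertV D y v ≡ true → D v ≡ true ⊎ v ≡ y
    insertV⁻ {v} = ∨-⌊⌋⁻ (D v) (v ≟ y)

  module _ (T : BGraph n) (x y : Fin n) where

    addArc⁺ˡ : ⟦ T ⟧ ⇒ ⟦ addArc T x y ⟧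
    addArc⁺ˡ = ∨⁺ˡ _

    addArc⁺ʳ : ⟦ addArc T x y ⟧ x y
    addArc⁺ʳ = ∨-⌊⌋⁺ʳ (T x y) (x ≟ x ×-dec y ≟ y) (refl , refl)

    addArc⁻ : ∀ {u v} → ⟦ addArc T x y ⟧ u v → ⟦ T ⟧ u v ⊎ (u ≡ x × v ≡ y)
    addArc⁻ {u} {v} = ∨-⌊⌋⁻ (T u v) (u ≟ x ×-dec v ≟ y)

module _ {n : ℕ} {D : VSet n} {A B : Graph n} where

  EnteringTreeOn-mono : A ⇒ B → ArcsIn D B → EnteringForest B → EnteringTreeOn D A → EnteringTreeOn D B
  EnteringTreeOn-mono A⇒B arcs forest (_ , _ , nonempty , conn) =
    arcs , forest , nonempty , λ u v u∈D v∈D → Conn-map A⇒B (conn u v u∈D v∈D)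

module _ {n : ℕ} {D : VSet n} {T : BGraph n} {x y : Fin n} where

  EnteringTreeOn-addArc : D x ≡ true → EnteringForest ⟦ addArc T x y ⟧ →
                          EnteringTreeOn D ⟦ T ⟧ → EnteringTreeOn (insertV D y) ⟦ addArc T x y ⟧
  EnteringTreeOn-addArc x∈D forest (arcs , _ , _ , conn) =
    arcs′ , forest , (x , insertV⁺ˡ D y x∈D) , λ u v u∈D′ v∈D′ → to-x u∈D′ ++ᶜ Conn-sym (to-x v∈D′)
    where
    arcs′ : ArcsIn (insertV D y) ⟦ addArc T x y ⟧
    arcs′ u v a with addArc⁻ T x y a
    ... | inj₁ t = let u∈D , v∈D = arcs u v t in insertV⁺ˡ D y u∈D , insertV⁺ˡ D y v∈D
    ... | inj₂ (refl , refl) = insertV⁺ˡ D y x∈D , insertV⁺ʳ D y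

    to-x : ∀ {u} → insertV D y u ≡ true → Conn ⟦ addArc T x y ⟧ u x
    to-x {u} u∈D′ with insertV⁻ D y u∈D′
    ... | inj₁ u∈D = Conn-map (addArc⁺ˡ T x y) (conn u x u∈D x∈D)
    ... | inj₂ refl = bwd (addArc⁺ʳ T x y) here

root-has-in-arc : ∀ {n} {A : Graph n} {r u} → Conn A r u → Root A r → r ≢ u → ∃[ v ] A v r
root-has-in-arc here _ r≢u = ⊥-elim (r≢u refl)
root-has-in-arc (fwd a _) root _ = ⊥-elim (root (_ , a))
root-has-in-arc (bwd a _) _ _ = _ , a

module _ {n m : ℕ} {p : Fin n → Fin m} {F : BGraph n} where

  -- The root r of a tree in 𝒯_XY lies outside X, so it is the added vertex and is entered from X.
  splitting⇒contraction : ∀ {X Y} → Splitting F p X Y → Contraction p ⟦ F ⟧ X Y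
  splitting⇒contraction {X}
    (X≢Y , y , T , (_ , T⊆F , (arcs , _ , _ , conn) , (_ , _ , (u , u∈X) , _)) , r , (r∈D , r-root) , refl)
    with root-has-in-arc (conn r u r∈D (insertV⁺ˡ (block p X) y u∈X)) (uncurry r-root) r≢u
    where
    r≢u : r ≢ u
    r≢u r≡u = X≢Y (trans (sym (⌊⌋⁻ (p u ≟ X) u∈X)) (cong p (sym r≡u)))
  ... | v , vr = X≢Y , v , r , T⊆F v r vr , v∈X , refl
    where
    r≡y : r ≡ y
    r≡y with insertV⁻ (block p X) y r∈D
    ... | inj₁ r∈X = ⊥-elim (X≢Y (sym (⌊⌋⁻ (p r ≟ X) r∈X)))
    ... | inj₂ r≡y = r≡y

    v∈X : p v ≡ X
    v∈X with insertV⁻ (block p X) y (proj₁ (arcs v r vr))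
    ... | inj₁ v∈X = ⌊⌋⁻ (p v ≟ X) v∈X
    ... | inj₂ v≡y = ⊥-elim (r-root r (subst (λ w → ⟦ T ⟧ w r) (trans v≡y (sym r≡y)) vr))

  contraction⇒splitting : EnteringForest ⟦ F ⟧ → TreeDivisible F p →
                          ∀ {X Y} → Contraction p ⟦ F ⟧ X Y → Splitting F p X Y
  contraction⇒splitting forest divisible (X≢Y , x , y , xy , refl , refl) with divisible (p x)
  ... | T , T⊆F , tree@(arcs , _) =
    X≢Y , y , T′ , (⌊⌋-false (p y ≟ p x) (X≢Y ∘ sym) , (λ _ _ → T′⊆F) , tree′ , restricted-tree) ,
    y , (insertV⁺ʳ (block p (p x)) y , curry y-root) , refl
    where
    T′ : BGraph n
    T′ = addArc T x y

    T′⊆F : ⟦ T′ ⟧ ⇒ ⟦ F ⟧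
    T′⊆F a with addArc⁻ T x y a
    ... | inj₁ t = T⊆F _ _ t
    ... | inj₂ (refl , refl) = xy

    tree′ : EnteringTreeOn (insertV (block p (p x)) y) ⟦ T′ ⟧
    tree′ = EnteringTreeOn-addArc (⌊⌋⁺ (p x ≟ p x) refl) (EnteringForest-sub T′⊆F forest) tree

    restricted-tree : EnteringTreeOn (block p (p x)) (restrict T′ (block p (p x)))
    restricted-tree = EnteringTreeOn-mono (λ t → addArc⁺ˡ T x y t , arcs _ _ t) (λ _ _ → proj₂)
                        (EnteringForest-sub (T′⊆F ∘ proj₁) forest) tree

    y-root : Root ⟦ T′ ⟧ y
    y-root (v , a) with addArc⁻ T x y a
    ... | inj₁ t = X≢Y (sym (⌊⌋⁻ (p y ≟ p x) (proj₁ (arcs y v t))))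
    ... | inj₂ (y≡x , _) = X≢Y (cong p (sym y≡x))

treeDivisible⇒blocksConnected : ∀ {n m} {p : Fin n → Fin m} {F : BGraph n} →
                                TreeDivisible F p → BlocksConnected p ⟦ F ⟧
treeDivisible⇒blocksConnected {p = p} {F} divisible u v same with divisible (p v)
... | T , T⊆F , (arcs , _ , _ , conn) =
  Conn-map intra (conn u v (⌊⌋⁺ (p u ≟ p v) same) (⌊⌋⁺ (p v ≟ p v) refl))
  where
  intra : ∀ {a b} → ⟦ T ⟧ a b → IntraBlock p ⟦ F ⟧ a b
  intra {a} {b} t = let a∈X , b∈X = arcs a b t in
    T⊆F a b t , trans (⌊⌋⁻ (p a ≟ p v) a∈X) (sym (⌊⌋⁻ (p b ≟ p v) b∈X))

proposition3 : {n m k : ℕ} {W : Set} (Ψ : BGraph n) (w : Fin n → Fin n → W)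
    (p : Fin n → Fin m) → IsPartition p →
    (F : BGraph n) → F ⊆G Ψ → EnteringForest ⟦ F ⟧ → HasComponents ⟦ F ⟧ k →
    TreeDivisible F p →
    EnteringForest (Splitting F p) × HasComponents (Splitting F p) k ×
    HasArcCount (Splitting F p) (m ∸ k)
proposition3 _ _ p partition F _ forest components divisible =
  EnteringForest-sub splitting⇒contraction contracted-forest ,
  HasComponents-resp ⇒splitting splitting⇒contraction contracted-components ,
  HasArcCount-resp ⇒splitting splitting⇒contraction
    (forest-arcCount (contraction? p λ u v → F u v Bool.≟ true) contracted-forest contracted-components)
  where
  connected : BlocksConnected p ⟦ F ⟧
  connected = treeDivisible⇒blocksConnected divisible

  ⇒splitting : Contraction p ⟦ F ⟧ ⇒ Splitting F p
  ⇒splitting = contraction⇒splitting forest divisible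

  contracted-forest : EnteringForest (Contraction p ⟦ F ⟧)
  contracted-forest = contraction-forest p connected forest

  contracted-components : HasComponents (Contraction p ⟦ F ⟧) _
  contracted-components = contraction-components p connected partition components
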